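{- Let $n$ be a positive integer with $4\mid n$, let $k$ be a nonnegative integer with $10\mid k$ and $k\leq \frac56 n$, and let $\delta=\frac45$. Let $R=(r_{i,j})_{i,j=1}^4$ be defined by $r_{i,j}=\frac{2k}{10}$ if $i=j$ or $i+j=5$, and $r_{i,j}=\frac{3k}{10}$ otherwise. Then $R$ is $(k,\delta)$-feasible and $E(R)=\delta k$.
   Context: Let $\mathcal{G}=[1,n]^2$ where $[a,b]=\{x\in\mathbb{Z}:a\le x\le b\}$. For $1\le i,j\le 4$ let $\mathcal{G}_{i,j}=[(i-1)\frac n4+1,i\frac n4]\times[(j-1)\frac n4+1,j\frac n4]$. A line of the plane is generic if it is neither horizontal nor vertical; $\mathcal{L}(\mathcal{G})$ is the set of generic lines meeting $\mathcal{G}$ in at least two points. For a matrix $R=(r_{i,j})\in[0,n/4]^{4\times4}$, set $\alpha_{i,j}=\frac{r_{i,j}}{n/4}$, $g_{i,j}(\ell)=|\mathcal{G}_{i,j}\cap\ell|$, $E_R(\ell)=\sum_{i,j}\alpha_{i,j}g_{i,j}(\ell)$ and $E(R)=\max\{E_R(\ell):\ell\in\mathcal{L}(\mathcal{G})\}$. For $\delta<1$ and $k\in\mathbb{N}$, $R$ is $(k,\delta)$-feasible if $E(R)\le\delta k$ and $\sum_{i'=1}^4 r_{i',j}=\sum_{j'=1}^4 r_{i,j'}=k$ for all $i,j\in[1,4]$. -}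

module Defs where

open import Data.Nat as ℕ using (ℕ; zero; suc; NonZero)
open import Data.Fin using (Fin; toℕ)
open import Data.Integer as ℤ using (ℤ; +_)
open import Data.Rational as ℚ using (ℚ)
open import Data.List using (List; map; filter; length; cartesianProduct; upTo)
open import Data.Product using (_×_; _,_; proj₁; proj₂; Σ)
open import Relation.Binary.PropositionalEquality using (_≡_; _≢_)
open import Relation.Nullary using (¬_)

-- Integer lattice points of the plane (coordinates are naturals here,
-- since all points considered lie in G = [1,n]^2).
Point : Set
Point = ℕ × ℕ

InGrid : ℕ → Point → Set
InGrid n (x , y) = (1 ℕ.≤ x × x ℕ.≤ n) × (1 ℕ.≤ y × y ℕ.≤ n)

-- A generic line meeting G in at least two points is exactly a line through
-- two points p, q of G that differ in both coordinates (so the line is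
-- neither horizontal nor vertical).
record GLine (n : ℕ) : Set where
  constructor mkLine
  field
    p q    : Point
    p∈G    : InGrid n p
    q∈G    : InGrid n q
    xdiff  : proj₁ p ≢ proj₁ q
    ydiff  : proj₂ p ≢ proj₂ q
open GLine public

onLineℤ : Point → Point → Point → ℤ × ℤ
onLineℤ (px , py) (qx , qy) (x , y) =
  ((+ x ℤ.- + px) ℤ.* (+ qy ℤ.- + py)) , ((+ y ℤ.- + py) ℤ.* (+ qx ℤ.- + px))

OnLine : ∀ {n} → GLine n → Point → Set
OnLine ℓ z = proj₁ (onLineℤ (p ℓ) (q ℓ) z) ≡ proj₂ (onLineℤ (p ℓ) (q ℓ) z)

onLine? : ∀ {n} (ℓ : GLine n) (z : Point) → Relation.Nullary.Dec (OnLine ℓ z)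
onLine? ℓ z = proj₁ (onLineℤ (p ℓ) (q ℓ) z) ℤ.≟ proj₂ (onLineℤ (p ℓ) (q ℓ) z)

-- the integer interval [(i-1)m+1, i m] for block index i ∈ Fin 4 (i = 0..3 ↔ 1..4)
blockRange : ℕ → Fin 4 → List ℕ
blockRange m i = map (λ t → toℕ i ℕ.* m ℕ.+ suc t) (upTo m)

block : ℕ → Fin 4 → Fin 4 → List Point
block m i j = cartesianProduct (blockRange m i) (blockRange m j)

g : (m : ℕ) → Fin 4 → Fin 4 → GLine (4 ℕ.* m) → ℕ
g m i j ℓ = length (filter (onLine? ℓ) (block m i j))

Σ4ℚ : (Fin 4 → ℚ) → ℚ
Σ4ℚ f = f Fin.zero ℚ.+ f (Fin.suc Fin.zero) ℚ.+ f (Fin.suc (Fin.suc Fin.zero))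
          ℚ.+ f (Fin.suc (Fin.suc (Fin.suc Fin.zero)))
  where import Data.Fin as Fin

Σ4 : (Fin 4 → ℕ) → ℕ
Σ4 f = f Fin.zero ℕ.+ f (Fin.suc Fin.zero) ℕ.+ f (Fin.suc (Fin.suc Fin.zero))
          ℕ.+ f (Fin.suc (Fin.suc (Fin.suc Fin.zero)))
  where import Data.Fin as Fin

ℕ→ℚ : ℕ → ℚ
ℕ→ℚ a = + a ℚ./ 1

Matrix : Set
Matrix = Fin 4 → Fin 4 → ℕ

α : (m : ℕ) .{{_ : NonZero m}} → Matrix → Fin 4 → Fin 4 → ℚ
α m R i j = + (R i j) ℚ./ m

E-R : (m : ℕ) .{{_ : NonZero m}} → Matrix → GLine (4 ℕ.* m) → ℚ
E-R m R ℓ = Σ4ℚ (λ i → Σ4ℚ (λ j → α m R i j ℚ.* ℕ→ℚ (g m i j ℓ)))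

-- E(R) ≤ c   (E(R) is the maximum of E_R over L(G))
E≤ : (m : ℕ) .{{_ : NonZero m}} → Matrix → ℚ → Set
E≤ m R c = (ℓ : GLine (4 ℕ.* m)) → E-R m R ℓ ℚ.≤ c

E≡ : (m : ℕ) .{{_ : NonZero m}} → Matrix → ℚ → Set
E≡ m R c = E≤ m R c × Σ (GLine (4 ℕ.* m)) (λ ℓ → E-R m R ℓ ≡ c)

Feasible : (m : ℕ) .{{_ : NonZero m}} → ℕ → ℚ → Matrix → Set
Feasible m k δ R =
  ((i j : Fin 4) → R i j ℕ.≤ m)
  × E≤ m R (δ ℚ.* ℕ→ℚ k)
  × ((j : Fin 4) → Σ4 (λ i' → R i' j) ≡ k)
  × ((i : Fin 4) → Σ4 (λ j' → R i j') ≡ k)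

-- the matrix of Lemma 3.5 (indices 0..3 stand for 1..4, so i+j=5 becomes i+j=3)
Rk : ℕ → Matrix
Rk k i j with toℕ i ℕ.≟ toℕ j | toℕ i ℕ.+ toℕ j ℕ.≟ 3
... | Relation.Nullary.yes _ | _ = 2 ℕ.* (k ℕ./ 10)
... | Relation.Nullary.no _ | Relation.Nullary.yes _ = 2 ℕ.* (k ℕ./ 10)
... | Relation.Nullary.no _ | Relation.Nullary.no _ = 3 ℕ.* (k ℕ./ 10)

δ₀ : ℚ
δ₀ = + 4 ℚ./ 5

-- Write k = 10c. Then R_k = c·W, where W has entries 2 on the diagonal and the antidiagonal and 3
-- elsewhere, so with m = n/4 the claim E(R_k) = (4/5)k says that Σ W_ij g_ij(ℓ) ≤ 8m for every line ℓ,
-- with equality for some ℓ.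
-- A line with |slope| ≠ 1 meets each column (if |slope| < 1) or each row (if |slope| > 1) at most once
-- and never two adjacent ones, so it has at most 2m points in G, each of weight at most 3.
-- A line of slope ±1 is cut into m slices according to the residue of x modulo m: the blocks met by
-- one slice lie on one diagonal (or antidiagonal) of the 4×4 block pattern, and each such diagonal has
-- W-weight at most 8. The main diagonal of G meets the blocks G_ii once per slice, which gives equality.

module Submission where

open import Defs
open import Data.Nat using (ℕ; zero; suc; _+_; _*_; _≤_; _<_; z≤n; s≤s; NonZero; >-nonZero; >-nonZero⁻¹; _≟_; _≤?_; _<?_)
open import Data.Nat.Properties
open import Data.Nat.DivMod using (_/_; /-congˡ; +-distrib-/-∣ˡ; m*n/n≡m; m<n⇒m/n≡0)
open import Data.Nat.Divisibility using (_∣_; divides; n∣m*n; ∣⇒≤)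
open import Data.Nat.Tactic.RingSolver using (solve-∀)
open import Data.Integer as ℤ using (ℤ; +_; -[1+_]; ∣_∣; 0ℤ; 1ℤ)
import Data.Integer.Properties as ℤₚ
open import Data.Integer.Tactic.RingSolver using () renaming (solve-∀ to ℤ-solve-∀)
open import Data.Rational as ℚ using (ℚ; toℚᵘ)
open import Data.Rational using () renaming (_*_ to _*ℚ_)
open import Data.Rational.Properties using (toℚᵘ-homo-+; toℚᵘ-homo-*; toℚᵘ-fromℚᵘ; toℚᵘ-cancel-≤; toℚᵘ-injective)
open import Data.Rational.Unnormalised as ℚᵘ using (mkℚᵘ; _≃_; *≡*; *≤*)
import Data.Rational.Unnormalised.Properties as ℚᵘₚ
open import Data.Fin as Fin using (Fin; toℕ)
open import Data.Fin.Properties using (all?; any?; toℕ-injective)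
open import Data.List using (filter; length; cartesianProduct; map; upTo; applyUpTo; _++_)
open import Data.List.Properties using (filter-++; length-++; map-applyUpTo; map-upTo)
open import Data.Product using (_×_; _,_; proj₁; proj₂; ∃-syntax)
open import Data.Sum using (_⊎_; inj₁; inj₂)
open import Data.Empty using (⊥; ⊥-elim)
open import Function using (_∘_)
open import Level using (Level)
open import Relation.Binary.Definitions using (Decidable; tri<; tri≈; tri>)
open import Relation.Binary.PropositionalEquality
open import Relation.Nullary using (Dec; yes; no; ¬_)
open import Relation.Nullary.Decidable using (from-yes)

-- Finite sums and counting

∑< : ℕ → (ℕ → ℕ) → ℕ
∑< zero    f = 0
∑< (suc L) f = f 0 + ∑< L (f ∘ suc)

infixl 10 ∑<
syntax ∑< L (λ t → e) = ∑[ t < L ] e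

∑-cong : ∀ L {f h : ℕ → ℕ} → (∀ t → t < L → f t ≡ h t) → ∑< L f ≡ ∑< L h
∑-cong zero    eq = refl
∑-cong (suc L) eq = cong₂ _+_ (eq 0 (s≤s z≤n)) (∑-cong L (λ t t<L → eq (suc t) (s≤s t<L)))

∑-mono-≤ : ∀ L {f h : ℕ → ℕ} → (∀ t → t < L → f t ≤ h t) → ∑< L f ≤ ∑< L h
∑-mono-≤ zero    le = z≤n
∑-mono-≤ (suc L) le = +-mono-≤ (le 0 (s≤s z≤n)) (∑-mono-≤ L (λ t t<L → le (suc t) (s≤s t<L)))

∑-const : ∀ L c → ∑[ t < L ] c ≡ L * c
∑-const zero    c = refl
∑-const (suc L) c = cong (_+_ c) (∑-const L c)

∑≡0 : ∀ L {f : ℕ → ℕ} → (∀ t → t < L → f t ≡ 0) → ∑< L f ≡ 0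
∑≡0 L f≡0 = trans (∑-cong L f≡0) (trans (∑-const L 0) (*-zeroʳ L))

∑-distrib-+ : ∀ L (f h : ℕ → ℕ) → ∑[ t < L ] (f t + h t) ≡ ∑< L f + ∑< L h
∑-distrib-+ zero    f h = refl
∑-distrib-+ (suc L) f h = begin
  f 0 + h 0 + ∑[ t < L ] (f (suc t) + h (suc t)) ≡⟨ cong (_+_ (f 0 + h 0)) (∑-distrib-+ L (f ∘ suc) (h ∘ suc)) ⟩
  f 0 + h 0 + (∑< L (f ∘ suc) + ∑< L (h ∘ suc))  ≡⟨ +-+-comm (f 0) (h 0) _ _ ⟩
  f 0 + ∑< L (f ∘ suc) + (h 0 + ∑< L (h ∘ suc))  ∎
  where
  open ≡-Reasoning
  +-+-comm : ∀ a b c d → a + b + (c + d) ≡ a + c + (b + d)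
  +-+-comm = solve-∀

*-distribˡ-∑ : ∀ L c (f : ℕ → ℕ) → c * ∑< L f ≡ ∑[ t < L ] (c * f t)
*-distribˡ-∑ zero    c f = *-zeroʳ c
*-distribˡ-∑ (suc L) c f = trans (*-distribˡ-+ c (f 0) _) (cong (_+_ (c * f 0)) (*-distribˡ-∑ L c (f ∘ suc)))

∑-split : ∀ L M (f : ℕ → ℕ) → ∑< (L + M) f ≡ ∑< L f + ∑[ t < M ] f (L + t)
∑-split zero    M f = refl
∑-split (suc L) M f = trans (cong (_+_ (f 0)) (∑-split L M (f ∘ suc))) (sym (+-assoc (f 0) _ _))

∑-comm : ∀ L M (h : ℕ → ℕ → ℕ) → ∑[ s < L ] ∑[ t < M ] h s t ≡ ∑[ t < M ] ∑[ s < L ] h s t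
∑-comm zero    M h = sym (∑≡0 M (λ _ _ → refl))
∑-comm (suc L) M h = trans (cong (_+_ (∑< M (h 0))) (∑-comm L M (h ∘ suc)))
                           (sym (∑-distrib-+ M (h 0) (λ t → ∑[ s < L ] h (suc s) t)))

∑-blocks : ∀ B m (f : ℕ → ℕ) → ∑[ b < B ] ∑[ s < m ] f (b * m + s) ≡ ∑< (B * m) f
∑-blocks zero    m f = refl
∑-blocks (suc B) m f = begin
  ∑< m f + ∑[ b < B ] ∑[ s < m ] f (suc b * m + s)
    ≡⟨ cong (_+_ (∑< m f)) (∑-cong B (λ b _ → ∑-cong m (λ s _ → cong f (+-assoc m (b * m) s)))) ⟩
  ∑< m f + ∑[ b < B ] ∑[ s < m ] f (m + (b * m + s))
    ≡⟨ cong (_+_ (∑< m f)) (∑-blocks B m (λ x → f (m + x))) ⟩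
  ∑< m f + ∑[ x < B * m ] f (m + x)
    ≡⟨ ∑-split m (B * m) f ⟨
  ∑< (m + B * m) f ∎
  where open ≡-Reasoning

∑>0⇒∃ : ∀ L {f : ℕ → ℕ} → 0 < ∑< L f → ∃[ t ] t < L × 0 < f t
∑>0⇒∃ (suc L) {f} pos with f 0 in f0≡
... | suc _ = 0 , s≤s z≤n , subst (0 <_) (sym f0≡) (s≤s z≤n)
... | zero  with ∑>0⇒∃ L pos
...   | t , t<L , ft>0 = suc t , s≤s t<L , ft>0

≤1-exclusive : ∀ {a b} → a ≤ 1 → b ≤ 1 → (0 < a → 0 < b → ⊥) → a + b ≤ 1
≤1-exclusive {zero}                _   b≤1 _    = b≤1
≤1-exclusive {suc zero} {zero}    a≤1 _   _    = a≤1
≤1-exclusive {suc zero} {suc _}   _   _   excl = ⊥-elim (excl (s≤s z≤n) (s≤s z≤n))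
≤1-exclusive {suc (suc a)} (s≤s ())

∑≤1 : ∀ L {f : ℕ → ℕ} → (∀ t → f t ≤ 1) → (∀ s t → 0 < f s → 0 < f t → s ≡ t) → ∑< L f ≤ 1
∑≤1 zero    _ _ = z≤n
∑≤1 (suc L) f≤1 unique =
  ≤1-exclusive (f≤1 0) (∑≤1 L (f≤1 ∘ suc) (λ s t p q → suc-injective (unique (suc s) (suc t) p q)))
    (λ f0>0 rest>0 → let (t , _ , ft>0) = ∑>0⇒∃ L rest>0 in 0≢1+n (unique 0 (suc t) f0>0 ft>0))

∑-nonadjacent : ∀ L {f : ℕ → ℕ} → (∀ t → f t + f (suc t) ≤ 1) → 2 * ∑< L f ≤ suc L
∑-nonadjacent zero          _   = z≤n
∑-nonadjacent (suc zero)    {f} adj = begin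
  2 * (f 0 + 0) ≡⟨ cong (2 *_) (+-identityʳ (f 0)) ⟩
  2 * f 0       ≤⟨ *-monoʳ-≤ 2 (m+n≤o⇒m≤o (f 0) (adj 0)) ⟩
  2             ∎
  where open ≤-Reasoning
∑-nonadjacent (suc (suc L)) {f} adj = begin
  2 * (f 0 + (f 1 + ∑< L (f ∘ suc ∘ suc)))   ≡⟨ regroup (f 0) (f 1) _ ⟩
  2 * (f 0 + f 1) + 2 * ∑< L (f ∘ suc ∘ suc) ≤⟨ +-mono-≤ (*-monoʳ-≤ 2 (adj 0)) (∑-nonadjacent L (adj ∘ suc ∘ suc)) ⟩
  2 + suc L ∎
  where
  open ≤-Reasoning
  regroup : ∀ a b c → 2 * (a + (b + c)) ≡ 2 * (a + b) + 2 * c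
  regroup = solve-∀

∑-single : ∀ L {f : ℕ → ℕ} t → t < L → f t ≡ 1 → (∀ s → s ≢ t → f s ≡ 0) → ∑< L f ≡ 1
∑-single (suc L) zero    _         ft≡1 rest = cong₂ _+_ ft≡1 (∑≡0 L (λ s _ → rest (suc s) λ ()))
∑-single (suc L) (suc t) (s≤s t<L) ft≡1 rest =
  cong₂ _+_ (rest 0 λ ()) (∑-single L t t<L ft≡1 (λ s s≢t → rest (suc s) (s≢t ∘ suc-injective)))

∑∑-sparse : ∀ L M (h : ℕ → ℕ → ℕ) → (∀ a b → h a b ≤ 1) →
  (∀ {a b b'} → 0 < h a b → 0 < h a b' → b ≡ b') → (∀ {a b b'} → 0 < h a b → 0 < h (suc a) b' → ⊥) →
  2 * ∑[ a < L ] ∑[ b < M ] h a b ≤ suc L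
∑∑-sparse L M h h≤1 unique isolated = ∑-nonadjacent L λ a →
  ≤1-exclusive (row≤1 a) (row≤1 (suc a)) λ row>0 next>0 →
    let (_ , _ , hab>0) = ∑>0⇒∃ M row>0; (_ , _ , h[a+1]b'>0) = ∑>0⇒∃ M next>0 in isolated hab>0 h[a+1]b'>0
  where
  row≤1 : ∀ a → ∑[ b < M ] h a b ≤ 1
  row≤1 a = ∑≤1 M (h≤1 a) (λ _ _ → unique)

2n≤1+4m⇒n≤2m : ∀ {n m} → 2 * n ≤ suc (4 * m) → n ≤ 2 * m
2n≤1+4m⇒n≤2m {n} {m} 2n≤1+4m = ≤-pred (*-cancelˡ-< 2 n (suc (2 * m)) (≤-trans (s≤s 2n≤1+4m) (≤-reflexive (double m))))
  where
  double : ∀ m → 2 + 4 * m ≡ 2 * suc (2 * m)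
  double = solve-∀

private variable
  ℓᴬ ℓᴮ ℓᴾ : Level
  A : Set ℓᴬ
  B : Set ℓᴮ
  P : Set ℓᴾ

𝟙 : Dec P → ℕ
𝟙 (yes _) = 1
𝟙 (no  _) = 0

𝟙≤1 : (P? : Dec P) → 𝟙 P? ≤ 1
𝟙≤1 (yes _) = s≤s z≤n
𝟙≤1 (no  _) = z≤n

𝟙>0⇒ : (P? : Dec P) → 0 < 𝟙 P? → P
𝟙>0⇒ (yes x) _ = x

𝟙-yes : (P? : Dec P) → P → 𝟙 P? ≡ 1
𝟙-yes (yes _) _  = refl
𝟙-yes (no ¬x) x = ⊥-elim (¬x x)

𝟙-no : (P? : Dec P) → ¬ P → 𝟙 P? ≡ 0
𝟙-no (yes x) ¬x = ⊥-elim (¬x x)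
𝟙-no (no  _) _  = refl

≤1⇒≤𝟙 : ∀ {n} → n ≤ 1 → (0 < n → P) → (P? : Dec P) → n ≤ 𝟙 P?
≤1⇒≤𝟙 {n = zero}  _   _      _       = z≤n
≤1⇒≤𝟙 {n = suc _} n≤1 n>0⇒P P? = ≤-trans n≤1 (≤-reflexive (sym (𝟙-yes P? (n>0⇒P (s≤s z≤n)))))

module _ {P : A → Set ℓᴾ} (P? : ∀ x → Dec (P x)) where

  count-++ : ∀ xs ys → length (filter P? (xs ++ ys)) ≡ length (filter P? xs) + length (filter P? ys)
  count-++ xs ys = trans (cong length (filter-++ P? xs ys)) (length-++ (filter P? xs))

  count-applyUpTo : ∀ L (f : ℕ → A) → length (filter P? (applyUpTo f L)) ≡ ∑[ t < L ] 𝟙 (P? (f t))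
  count-applyUpTo zero    f = refl
  count-applyUpTo (suc L) f with P? (f 0)
  ... | yes _ = cong suc (count-applyUpTo L (f ∘ suc))
  ... | no  _ = count-applyUpTo L (f ∘ suc)

module _ {P : A × B → Set ℓᴾ} (P? : ∀ z → Dec (P z)) where

  count-cartesianProduct : ∀ L M (f : ℕ → A) (h : ℕ → B) →
    length (filter P? (cartesianProduct (applyUpTo f L) (applyUpTo h M))) ≡ ∑[ s < L ] ∑[ t < M ] 𝟙 (P? (f s , h t))
  count-cartesianProduct zero    M f h = refl
  count-cartesianProduct (suc L) M f h = begin
    length (filter P? (map (f 0 ,_) (applyUpTo h M) ++ cartesianProduct (applyUpTo (f ∘ suc) L) (applyUpTo h M)))
      ≡⟨ count-++ P? (map (f 0 ,_) (applyUpTo h M)) _ ⟩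
    length (filter P? (map (f 0 ,_) (applyUpTo h M))) + length (filter P? (cartesianProduct (applyUpTo (f ∘ suc) L) (applyUpTo h M)))
      ≡⟨ cong₂ _+_ (cong (length ∘ filter P?) (map-applyUpTo h (f 0 ,_) M)) (count-cartesianProduct L M (f ∘ suc) h) ⟩
    length (filter P? (applyUpTo (λ t → f 0 , h t) M)) + ∑[ s < L ] ∑[ t < M ] 𝟙 (P? (f (suc s) , h t))
      ≡⟨ cong (_+ _) (count-applyUpTo P? M (λ t → f 0 , h t)) ⟩
    ∑[ t < M ] 𝟙 (P? (f 0 , h t)) + ∑[ s < L ] ∑[ t < M ] 𝟙 (P? (f (suc s) , h t)) ∎
    where open ≡-Reasoning

-- Lattice points on a generic line

+m-+n≡0⇒m≡n : ∀ {m n} → + m ℤ.- + n ≡ 0ℤ → m ≡ n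
+m-+n≡0⇒m≡n eq = ℤₚ.+-injective (ℤₚ.i-j≡0⇒i≡j _ _ eq)

+-exchange : ∀ {a b c d} → b ℤ.- a ≡ d ℤ.- c → c ℤ.+ b ≡ d ℤ.+ a
+-exchange {a} {b} {c} {d} eq = begin
  c ℤ.+ b                 ≡⟨ split c b a ⟩
  c ℤ.+ (b ℤ.- a) ℤ.+ a   ≡⟨ cong (λ z → c ℤ.+ z ℤ.+ a) eq ⟩
  c ℤ.+ (d ℤ.- c) ℤ.+ a   ≡⟨ cancel c d a ⟩
  d ℤ.+ a                 ∎
  where
  open ≡-Reasoning
  split : ∀ c b a → c ℤ.+ b ≡ c ℤ.+ (b ℤ.- a) ℤ.+ a
  split = ℤ-solve-∀
  cancel : ∀ c d a → c ℤ.+ (d ℤ.- c) ℤ.+ a ≡ d ℤ.+ a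
  cancel = ℤ-solve-∀

∣i∣≡∣j∣⇒i≡±j : ∀ i j → ∣ i ∣ ≡ ∣ j ∣ → i ≡ j ⊎ i ≡ ℤ.- j
∣i∣≡∣j∣⇒i≡±j (+ _)    (+ _)    eq   = inj₁ (cong +_ eq)
∣i∣≡∣j∣⇒i≡±j (+ _)    -[1+ _ ] refl = inj₂ refl
∣i∣≡∣j∣⇒i≡±j -[1+ _ ] (+ _)    refl = inj₂ refl
∣i∣≡∣j∣⇒i≡±j -[1+ _ ] -[1+ _ ] refl = inj₁ refl

*≡0⇒≡0 : ∀ {i j} → j ≢ 0ℤ → i ℤ.* j ≡ 0ℤ → i ≡ 0ℤ
*≡0⇒≡0 {i} j≢0 ij≡0 with ℤₚ.i*j≡0⇒i≡0∨j≡0 i ij≡0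
... | inj₁ i≡0 = i≡0
... | inj₂ j≡0 = ⊥-elim (j≢0 j≡0)

multiple⇒∣≤∣ : ∀ {i j} k → i ≢ 0ℤ → i ≡ k ℤ.* j → ∣ j ∣ ≤ ∣ i ∣
multiple⇒∣≤∣ {i} {j} k i≢0 i≡kj =
  ∣⇒≤ {{ℤ.≢-nonZero i≢0}} (divides ∣ k ∣ (trans (cong ∣_∣ i≡kj) (ℤₚ.abs-* k j)))

module _ {n} (ℓ : GLine n) where

  Δx Δy : ℤ
  Δx = + proj₁ (q ℓ) ℤ.- + proj₁ (p ℓ)
  Δy = + proj₂ (q ℓ) ℤ.- + proj₂ (p ℓ)

  Δx≢0 : Δx ≢ 0ℤ
  Δx≢0 eq = xdiff ℓ (sym (+m-+n≡0⇒m≡n eq))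

  Δy≢0 : Δy ≢ 0ℤ
  Δy≢0 eq = ydiff ℓ (sym (+m-+n≡0⇒m≡n eq))

  OnLine-diff : ∀ {x₁ y₁ x₂ y₂} → OnLine ℓ (x₁ , y₁) → OnLine ℓ (x₂ , y₂) →
                (+ x₂ ℤ.- + x₁) ℤ.* Δy ≡ (+ y₂ ℤ.- + y₁) ℤ.* Δx
  OnLine-diff {x₁} {y₁} {x₂} {y₂} on₁ on₂ = begin
    (+ x₂ ℤ.- + x₁) ℤ.* Δy                                ≡⟨ through (+ x₂) (+ x₁) px Δy ⟩
    (+ x₂ ℤ.- px) ℤ.* Δy ℤ.- (+ x₁ ℤ.- px) ℤ.* Δy           ≡⟨ cong₂ ℤ._-_ on₂ on₁ ⟩
    (+ y₂ ℤ.- py) ℤ.* Δx ℤ.- (+ y₁ ℤ.- py) ℤ.* Δx           ≡⟨ through (+ y₂) (+ y₁) py Δx ⟨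
    (+ y₂ ℤ.- + y₁) ℤ.* Δx                                ∎
    where
    open ≡-Reasoning
    px = + proj₁ (p ℓ)
    py = + proj₂ (p ℓ)
    through : ∀ a b c d → (a ℤ.- b) ℤ.* d ≡ (a ℤ.- c) ℤ.* d ℤ.- (b ℤ.- c) ℤ.* d
    through = ℤ-solve-∀

  private
    [a-a]*d≡0 : ∀ a d → (a ℤ.- a) ℤ.* d ≡ 0ℤ
    [a-a]*d≡0 = ℤ-solve-∀

    [1+a-a]*d≡d : ∀ a d → (1ℤ ℤ.+ a ℤ.- a) ℤ.* d ≡ d
    [1+a-a]*d≡d = ℤ-solve-∀

  OnLine-sameColumn : ∀ {x y₁ y₂} → OnLine ℓ (x , y₁) → OnLine ℓ (x , y₂) → y₁ ≡ y₂
  OnLine-sameColumn {x} on₁ on₂ =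
    sym (+m-+n≡0⇒m≡n (*≡0⇒≡0 Δx≢0 (trans (sym (OnLine-diff on₁ on₂)) ([a-a]*d≡0 (+ x) Δy))))

  OnLine-sameRow : ∀ {x₁ x₂ y} → OnLine ℓ (x₁ , y) → OnLine ℓ (x₂ , y) → x₁ ≡ x₂
  OnLine-sameRow {y = y} on₁ on₂ =
    sym (+m-+n≡0⇒m≡n (*≡0⇒≡0 Δy≢0 (trans (OnLine-diff on₁ on₂) ([a-a]*d≡0 (+ y) Δx))))

  OnLine-flat : ∣ Δy ∣ < ∣ Δx ∣ → ∀ {x y₁ y₂} → OnLine ℓ (x , y₁) → ¬ OnLine ℓ (suc x , y₂)
  OnLine-flat ∣Δy∣<∣Δx∣ {x} {y₁} {y₂} on₁ on₂ = <⇒≱ ∣Δy∣<∣Δx∣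
    (multiple⇒∣≤∣ (+ y₂ ℤ.- + y₁) Δy≢0 (trans (sym ([1+a-a]*d≡d (+ x) Δy)) (OnLine-diff on₁ on₂)))

  OnLine-steep : ∣ Δx ∣ < ∣ Δy ∣ → ∀ {x₁ x₂ y} → OnLine ℓ (x₁ , y) → ¬ OnLine ℓ (x₂ , suc y)
  OnLine-steep ∣Δx∣<∣Δy∣ {x₁} {x₂} {y} on₁ on₂ = <⇒≱ ∣Δx∣<∣Δy∣
    (multiple⇒∣≤∣ (+ x₂ ℤ.- + x₁) Δx≢0 (trans (sym ([1+a-a]*d≡d (+ y) Δx)) (sym (OnLine-diff on₁ on₂))))

  OnLine-diagonal : Δy ≡ Δx → ∀ {x₁ y₁ x₂ y₂} → OnLine ℓ (x₁ , y₁) → OnLine ℓ (x₂ , y₂) →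
                    y₁ + x₂ ≡ y₂ + x₁
  OnLine-diagonal Δy≡Δx {x₁} {y₁} {x₂} {y₂} on₁ on₂ =
    ℤₚ.+-injective (+-exchange {+ x₁} {+ x₂} {+ y₁} {+ y₂} (ℤₚ.*-cancelʳ-≡ _ _ Δx {{ℤ.≢-nonZero Δx≢0}}
      (trans (cong ((+ x₂ ℤ.- + x₁) ℤ.*_) (sym Δy≡Δx)) (OnLine-diff on₁ on₂))))

  OnLine-antidiagonal : Δy ≡ ℤ.- Δx → ∀ {x₁ y₁ x₂ y₂} → OnLine ℓ (x₁ , y₁) → OnLine ℓ (x₂ , y₂) →
                        y₁ + x₁ ≡ y₂ + x₂
  OnLine-antidiagonal Δy≡-Δx {x₁} {y₁} {x₂} {y₂} on₁ on₂ =
    ℤₚ.+-injective (+-exchange {+ x₂} {+ x₁} {+ y₁} {+ y₂} (ℤₚ.*-cancelʳ-≡ _ _ Δx {{ℤ.≢-nonZero Δx≢0}}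
      (trans (negate (+ x₂) (+ x₁) Δx) (trans (cong ((+ x₂ ℤ.- + x₁) ℤ.*_) (sym Δy≡-Δx)) (OnLine-diff on₁ on₂)))))
    where
    negate : ∀ a b d → (b ℤ.- a) ℤ.* d ≡ (a ℤ.- b) ℤ.* ℤ.- d
    negate = ℤ-solve-∀

  data Slope : Set where
    flat         : ∣ Δy ∣ < ∣ Δx ∣ → Slope
    steep        : ∣ Δx ∣ < ∣ Δy ∣ → Slope
    diagonal     : Δy ≡ Δx → Slope
    antidiagonal : Δy ≡ ℤ.- Δx → Slope

  slope : Slope
  slope with <-cmp ∣ Δy ∣ ∣ Δx ∣
  ... | tri< ∣Δy∣<∣Δx∣ _ _ = flat ∣Δy∣<∣Δx∣
  ... | tri> _ _ ∣Δx∣<∣Δy∣ = steep ∣Δx∣<∣Δy∣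
  ... | tri≈ _ ∣Δy∣≡∣Δx∣ _ with ∣i∣≡∣j∣⇒i≡±j Δy Δx ∣Δy∣≡∣Δx∣
  ...   | inj₁ Δy≡Δx  = diagonal Δy≡Δx
  ...   | inj₂ Δy≡-Δx = antidiagonal Δy≡-Δx

-- 4×4 matrices and the weight pattern W

Σ4-cong : ∀ {f h : Fin 4 → ℕ} → (∀ i → f i ≡ h i) → Σ4 f ≡ Σ4 h
Σ4-cong eq = cong₂ _+_ (cong₂ _+_ (cong₂ _+_ (eq _) (eq _)) (eq _)) (eq _)

Σ4-mono-≤ : ∀ {f h : Fin 4 → ℕ} → (∀ i → f i ≤ h i) → Σ4 f ≤ Σ4 h
Σ4-mono-≤ le = +-mono-≤ (+-mono-≤ (+-mono-≤ (le _) (le _)) (le _)) (le _)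

*-distribˡ-Σ4 : ∀ c (f : Fin 4 → ℕ) → c * Σ4 f ≡ Σ4 (λ i → c * f i)
*-distribˡ-Σ4 c f = distrib c (f _) (f _) (f _) (f _)
  where
  distrib : ∀ c a b d e → c * (a + b + d + e) ≡ c * a + c * b + c * d + c * e
  distrib = solve-∀

*-distribʳ-Σ4 : ∀ c (f : Fin 4 → ℕ) → Σ4 f * c ≡ Σ4 (λ i → f i * c)
*-distribʳ-Σ4 c f = distrib c (f _) (f _) (f _) (f _)
  where
  distrib : ∀ c a b d e → (a + b + d + e) * c ≡ a * c + b * c + d * c + e * c
  distrib = solve-∀

Σ4-∑ : ∀ L (f : Fin 4 → ℕ → ℕ) → Σ4 (λ i → ∑< L (f i)) ≡ ∑[ t < L ] Σ4 (λ i → f i t)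
Σ4-∑ L f = sym (begin
  ∑[ t < L ] (f₀ t + f₁ t + f₂ t + f₃ t)                    ≡⟨ ∑-distrib-+ L (λ t → f₀ t + f₁ t + f₂ t) f₃ ⟩
  ∑[ t < L ] (f₀ t + f₁ t + f₂ t) + ∑< L f₃                 ≡⟨ cong (_+ ∑< L f₃) (∑-distrib-+ L (λ t → f₀ t + f₁ t) f₂) ⟩
  ∑[ t < L ] (f₀ t + f₁ t) + ∑< L f₂ + ∑< L f₃              ≡⟨ cong (λ s → s + ∑< L f₂ + ∑< L f₃) (∑-distrib-+ L f₀ f₁) ⟩
  ∑< L f₀ + ∑< L f₁ + ∑< L f₂ + ∑< L f₃                     ∎)
  where
  open ≡-Reasoning
  f₀ = f Fin.zero
  f₁ = f (Fin.suc Fin.zero)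
  f₂ = f (Fin.suc (Fin.suc Fin.zero))
  f₃ = f (Fin.suc (Fin.suc (Fin.suc Fin.zero)))

Σ4-blocks : ∀ m (f : ℕ → ℕ) → Σ4 (λ i → ∑[ s < m ] f (toℕ i * m + s)) ≡ ∑< (4 * m) f
Σ4-blocks m f = trans (reassoc (F 0) (F 1) (F 2) (F 3)) (∑-blocks 4 m f)
  where
  F : ℕ → ℕ
  F b = ∑[ s < m ] f (b * m + s)
  reassoc : ∀ a b c d → a + b + c + d ≡ a + (b + (c + (d + 0)))
  reassoc = solve-∀

Cell : Set
Cell = Fin 4 × Fin 4

infix 4 _≤ᴹ_
_≤ᴹ_ : Matrix → Matrix → Set
A ≤ᴹ B = ∀ i j → A i j ≤ B i j

total : Matrix → ℕ
total B = Σ4 λ i → Σ4 (B i)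

infix 7 _·_
_·_ : Matrix → Matrix → ℕ
A · B = Σ4 λ i → Σ4 λ j → A i j * B i j

·-mono-≤ : ∀ {A A' B B'} → A ≤ᴹ A' → B ≤ᴹ B' → A · B ≤ A' · B'
·-mono-≤ A≤A' B≤B' = Σ4-mono-≤ λ i → Σ4-mono-≤ λ j → *-mono-≤ (A≤A' i j) (B≤B' i j)

·-congʳ : ∀ A {B B'} → (∀ i j → B i j ≡ B' i j) → A · B ≡ A · B'
·-congʳ A eq = Σ4-cong λ i → Σ4-cong λ j → cong (A i j *_) (eq i j)

·-∑ʳ : ∀ L A (F : ℕ → Matrix) → A · (λ i j → ∑[ s < L ] F s i j) ≡ ∑[ s < L ] (A · F s)
·-∑ʳ L A F = begin
  A · (λ i j → ∑[ s < L ] F s i j)                  ≡⟨ Σ4-cong (λ i → Σ4-cong λ j → *-distribˡ-∑ L (A i j) (λ s → F s i j)) ⟩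
  Σ4 (λ i → Σ4 λ j → ∑[ s < L ] (A i j * F s i j))  ≡⟨ Σ4-cong (λ i → Σ4-∑ L (λ j s → A i j * F s i j)) ⟩
  Σ4 (λ i → ∑[ s < L ] Σ4 λ j → A i j * F s i j)    ≡⟨ Σ4-∑ L (λ i s → Σ4 λ j → A i j * F s i j) ⟩
  ∑[ s < L ] (A · F s)                              ∎
  where open ≡-Reasoning

scaleˡ-· : ∀ c A B → (λ i j → A i j * c) · B ≡ c * (A · B)
scaleˡ-· c A B = begin
  (λ i j → A i j * c) · B                ≡⟨ Σ4-cong (λ i → Σ4-cong λ j → swap (A i j) c (B i j)) ⟩
  Σ4 (λ i → Σ4 λ j → c * (A i j * B i j)) ≡⟨ Σ4-cong (λ i → *-distribˡ-Σ4 c (λ j → A i j * B i j)) ⟨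
  Σ4 (λ i → c * Σ4 λ j → A i j * B i j)   ≡⟨ *-distribˡ-Σ4 c (λ i → Σ4 λ j → A i j * B i j) ⟨
  c * (A · B)                             ∎
  where
  open ≡-Reasoning
  swap : ∀ a c b → a * c * b ≡ c * (a * b)
  swap = solve-∀

const-· : ∀ c B → (λ _ _ → c) · B ≡ c * total B
const-· c B = trans (sym (Σ4-cong λ i → *-distribˡ-Σ4 c (B i))) (sym (*-distribˡ-Σ4 c (λ i → Σ4 (B i))))

W : Matrix
W = Rk 10

Rk≡W*[k/10] : ∀ k i j → Rk k i j ≡ W i j * (k / 10)
Rk≡W*[k/10] k i j with toℕ i ≟ toℕ j | toℕ i + toℕ j ≟ 3
... | yes _ | _     = refl
... | no _  | yes _ = refl
... | no _  | no _  = refl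

W≤3 : W ≤ᴹ λ _ _ → 3
W≤3 = from-yes (all? λ i → all? λ j → W i j ≤? 3)

W-rowSum : ∀ i → Σ4 (W i) ≡ 10
W-rowSum = from-yes (all? λ i → Σ4 (W i) ≟ 10)

W-colSum : ∀ j → Σ4 (λ i → W i j) ≡ 10
W-colSum = from-yes (all? λ j → Σ4 (λ i → W i j) ≟ 10)

SameDiagonal SameAntidiagonal : Cell → Cell → Set
SameDiagonal     (i , j) (i' , j') = toℕ j + toℕ i' ≡ toℕ j' + toℕ i
SameAntidiagonal (i , j) (i' , j') = toℕ j + toℕ i  ≡ toℕ j' + toℕ i'

sameDiagonal? : Decidable SameDiagonal
sameDiagonal? (i , j) (i' , j') = toℕ j + toℕ i' ≟ toℕ j' + toℕ i

sameAntidiagonal? : Decidable SameAntidiagonal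
sameAntidiagonal? (i , j) (i' , j') = toℕ j + toℕ i ≟ toℕ j' + toℕ i'

class : ∀ {_∼_ : Cell → Cell → Set} → Decidable _∼_ → Cell → Matrix
class _∼?_ c i j = 𝟙 (c ∼? (i , j))

W·diagonal≤8 : ∀ c → W · class sameDiagonal? c ≤ 8
W·diagonal≤8 (i₀ , j₀) = from-yes (all? λ i → all? λ j → W · class sameDiagonal? (i , j) ≤? 8) i₀ j₀

W·antidiagonal≤8 : ∀ c → W · class sameAntidiagonal? c ≤ 8
W·antidiagonal≤8 (i₀ , j₀) = from-yes (all? λ i → all? λ j → W · class sameAntidiagonal? (i , j) ≤? 8) i₀ j₀

W·identity≡8 : W · (λ i j → 𝟙 (i Fin.≟ j)) ≡ 8
W·identity≡8 = refl

W·≤8-supportedInClass : ∀ {_∼_ : Cell → Cell → Set} (_∼?_ : Decidable _∼_) → (∀ c → W · class _∼?_ c ≤ 8) →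
       ∀ P → P ≤ᴹ (λ _ _ → 1) → (∀ i j i' j' → 0 < P i j → 0 < P i' j' → (i , j) ∼ (i' , j')) → W · P ≤ 8
W·≤8-supportedInClass {_∼_} _∼?_ W·class≤8 P P≤1 coherent =
  ≤-trans (·-mono-≤ {W} (λ _ _ → ≤-refl) (λ i j → ≤1⇒≤𝟙 (P≤1 i j) (inClass i j) (c ∼? (i , j)))) (W·class≤8 c)
  where
  supportInOneClass : ∃[ c ] ∀ i j → 0 < P i j → c ∼ (i , j)
  supportInOneClass with any? (λ i → any? λ j → 0 <? P i j)
  ... | yes (i₀ , j₀ , P₀>0) = (i₀ , j₀) , λ i j → coherent i₀ j₀ i j P₀>0
  ... | no  P≡0              = (Fin.zero , Fin.zero) , λ i j P>0 → ⊥-elim (P≡0 (i , j , P>0))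
  c = proj₁ supportInOneClass
  inClass = proj₂ supportInOneClass

-- Weighted block counts of a line in G = [1,4m]²

[a*m+t]/m≡a : ∀ a {m t} .{{_ : NonZero m}} → t < m → (a * m + t) / m ≡ a
[a*m+t]/m≡a a {m} {t} t<m = begin
  (a * m + t) / m   ≡⟨ +-distrib-/-∣ˡ t (n∣m*n a) ⟩
  a * m / m + t / m ≡⟨ cong₂ _+_ (m*n/n≡m a m) (m<n⇒m/n≡0 t<m) ⟩
  a + 0             ≡⟨ +-identityʳ a ⟩
  a                 ∎
  where open ≡-Reasoning

quotient-unique : ∀ {m a a' t t'} → t < m → t' < m → a * m + t ≡ a' * m + t' → a ≡ a'
quotient-unique {m} {a} {a'} {t} {t'} t<m t'<m eq = begin
  a                 ≡⟨ [a*m+t]/m≡a a t<m ⟨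
  (a * m + t) / m   ≡⟨ /-congˡ eq ⟩
  (a' * m + t') / m ≡⟨ [a*m+t]/m≡a a' t'<m ⟩
  a'                ∎
  where
  open ≡-Reasoning
  instance
    m≢0 : NonZero m
    m≢0 = >-nonZero (≤-<-trans z≤n t<m)

χ : ∀ {n} → GLine n → ℕ → ℕ → ℕ
χ ℓ x y = 𝟙 (onLine? ℓ (x , y))

blockCounts : (m : ℕ) → GLine (4 * m) → Matrix
blockCounts m ℓ i j = g m i j ℓ

slice : (m : ℕ) → GLine (4 * m) → ℕ → Matrix
slice m ℓ s i j = ∑[ t < m ] χ ℓ (suc (toℕ i * m + s)) (suc (toℕ j * m + t))

blockCounts≡∑slice : ∀ m ℓ i j → blockCounts m ℓ i j ≡ ∑[ s < m ] slice m ℓ s i j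
blockCounts≡∑slice m ℓ i j = begin
  length (filter (onLine? ℓ) (cartesianProduct (map xᵢ (upTo m)) (map yⱼ (upTo m))))
    ≡⟨ cong₂ (λ xs ys → length (filter (onLine? ℓ) (cartesianProduct xs ys))) (map-upTo xᵢ m) (map-upTo yⱼ m) ⟩
  length (filter (onLine? ℓ) (cartesianProduct (applyUpTo xᵢ m) (applyUpTo yⱼ m)))
    ≡⟨ count-cartesianProduct (onLine? ℓ) m m xᵢ yⱼ ⟩
  ∑[ s < m ] ∑[ t < m ] χ ℓ (xᵢ s) (yⱼ t)
    ≡⟨ ∑-cong m (λ s _ → ∑-cong m λ t _ → cong₂ (χ ℓ) (+-suc _ s) (+-suc _ t)) ⟩
  ∑[ s < m ] slice m ℓ s i j ∎
  where
  open ≡-Reasoning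
  xᵢ yⱼ : ℕ → ℕ
  xᵢ s = toℕ i * m + suc s
  yⱼ t = toℕ j * m + suc t

W·blockCounts≡∑slices : ∀ m ℓ → W · blockCounts m ℓ ≡ ∑[ s < m ] (W · slice m ℓ s)
W·blockCounts≡∑slices m ℓ = trans (·-congʳ W (blockCounts≡∑slice m ℓ)) (·-∑ʳ m W (slice m ℓ))

total-blockCounts : ∀ m ℓ → total (blockCounts m ℓ) ≡ ∑[ x < 4 * m ] ∑[ y < 4 * m ] χ ℓ (suc x) (suc y)
total-blockCounts m ℓ = begin
  Σ4 (λ i → Σ4 λ j → blockCounts m ℓ i j)
    ≡⟨ Σ4-cong (λ i → Σ4-cong λ j → blockCounts≡∑slice m ℓ i j) ⟩
  Σ4 (λ i → Σ4 λ j → ∑[ s < m ] slice m ℓ s i j)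
    ≡⟨ Σ4-cong (λ i → Σ4-∑ m λ j s → slice m ℓ s i j) ⟩
  Σ4 (λ i → ∑[ s < m ] Σ4 λ j → slice m ℓ s i j)
    ≡⟨ Σ4-cong (λ i → ∑-cong m λ s _ → Σ4-blocks m λ y → χ ℓ (suc (toℕ i * m + s)) (suc y)) ⟩
  Σ4 (λ i → ∑[ s < m ] ∑[ y < 4 * m ] χ ℓ (suc (toℕ i * m + s)) (suc y))
    ≡⟨ Σ4-blocks m (λ x → ∑[ y < 4 * m ] χ ℓ (suc x) (suc y)) ⟩
  ∑[ x < 4 * m ] ∑[ y < 4 * m ] χ ℓ (suc x) (suc y) ∎
  where open ≡-Reasoning

blockSums-unique : ∀ {m s t t'} a b a' b' → t < m → t' < m →
  suc (a * m + t) + suc (b * m + s) ≡ suc (a' * m + t') + suc (b' * m + s) → a + b ≡ a' + b'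
blockSums-unique {m} {s} {t} {t'} a b a' b' t<m t'<m eq =
  quotient-unique t<m t'<m (+-cancelʳ-≡ (2 + s) _ _ (trans (sym (regroup a b m t s)) (trans eq (regroup a' b' m t' s))))
  where
  regroup : ∀ a b m t s → suc (a * m + t) + suc (b * m + s) ≡ (a + b) * m + t + (2 + s)
  regroup = solve-∀

module _ (m : ℕ) (ℓ : GLine (4 * m)) where

  slice≤1 : ∀ s → slice m ℓ s ≤ᴹ λ _ _ → 1
  slice≤1 s i j = ∑≤1 m (λ _ → 𝟙≤1 _) λ _ _ on on' →
    +-cancelˡ-≡ (toℕ j * m) _ _ (suc-injective (OnLine-sameColumn ℓ (𝟙>0⇒ _ on) (𝟙>0⇒ _ on')))

  slice-diagonal : Δy ℓ ≡ Δx ℓ → ∀ s i j i' j' → 0 < slice m ℓ s i j → 0 < slice m ℓ s i' j' →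
                   SameDiagonal (i , j) (i' , j')
  slice-diagonal Δy≡Δx s i j i' j' P>0 P'>0 =
    let (_ , t<m , on) = ∑>0⇒∃ m P>0; (_ , t'<m , on') = ∑>0⇒∃ m P'>0 in
    blockSums-unique (toℕ j) (toℕ i') (toℕ j') (toℕ i) t<m t'<m (OnLine-diagonal ℓ Δy≡Δx (𝟙>0⇒ _ on) (𝟙>0⇒ _ on'))

  slice-antidiagonal : Δy ℓ ≡ ℤ.- Δx ℓ → ∀ s i j i' j' → 0 < slice m ℓ s i j → 0 < slice m ℓ s i' j' →
                       SameAntidiagonal (i , j) (i' , j')
  slice-antidiagonal Δy≡-Δx s i j i' j' P>0 P'>0 =
    let (_ , t<m , on) = ∑>0⇒∃ m P>0; (_ , t'<m , on') = ∑>0⇒∃ m P'>0 in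
    blockSums-unique (toℕ j) (toℕ i) (toℕ j') (toℕ i') t<m t'<m (OnLine-antidiagonal ℓ Δy≡-Δx (𝟙>0⇒ _ on) (𝟙>0⇒ _ on'))

  total-flat : ∣ Δy ℓ ∣ < ∣ Δx ℓ ∣ → 2 * total (blockCounts m ℓ) ≤ suc (4 * m)
  total-flat ∣Δy∣<∣Δx∣ = begin
    2 * total (blockCounts m ℓ)                            ≡⟨ cong (2 *_) (total-blockCounts m ℓ) ⟩
    2 * ∑[ x < 4 * m ] ∑[ y < 4 * m ] χ ℓ (suc x) (suc y)   ≤⟨ ∑∑-sparse (4 * m) (4 * m) (λ x y → χ ℓ (suc x) (suc y))
                                                                (λ _ _ → 𝟙≤1 _)
                                                                (λ on on' → suc-injective (OnLine-sameColumn ℓ (𝟙>0⇒ _ on) (𝟙>0⇒ _ on')))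
                                                                (λ on on' → OnLine-flat ℓ ∣Δy∣<∣Δx∣ (𝟙>0⇒ _ on) (𝟙>0⇒ _ on')) ⟩
    suc (4 * m)                                            ∎
    where open ≤-Reasoning

  total-steep : ∣ Δx ℓ ∣ < ∣ Δy ℓ ∣ → 2 * total (blockCounts m ℓ) ≤ suc (4 * m)
  total-steep ∣Δx∣<∣Δy∣ = begin
    2 * total (blockCounts m ℓ)                            ≡⟨ cong (2 *_) (total-blockCounts m ℓ) ⟩
    2 * ∑[ x < 4 * m ] ∑[ y < 4 * m ] χ ℓ (suc x) (suc y)   ≡⟨ cong (2 *_) (∑-comm (4 * m) (4 * m) λ x y → χ ℓ (suc x) (suc y)) ⟩
    2 * ∑[ y < 4 * m ] ∑[ x < 4 * m ] χ ℓ (suc x) (suc y)   ≤⟨ ∑∑-sparse (4 * m) (4 * m) (λ y x → χ ℓ (suc x) (suc y))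
                                                                (λ _ _ → 𝟙≤1 _)
                                                                (λ on on' → suc-injective (OnLine-sameRow ℓ (𝟙>0⇒ _ on) (𝟙>0⇒ _ on')))
                                                                (λ on on' → OnLine-steep ℓ ∣Δx∣<∣Δy∣ (𝟙>0⇒ _ on) (𝟙>0⇒ _ on')) ⟩
    suc (4 * m)                                            ∎
    where open ≤-Reasoning

  fewPoints⇒W·blockCounts≤8m : 2 * total (blockCounts m ℓ) ≤ suc (4 * m) → W · blockCounts m ℓ ≤ 8 * m
  fewPoints⇒W·blockCounts≤8m 2T≤1+4m = begin
    W · blockCounts m ℓ             ≤⟨ ·-mono-≤ {B = blockCounts m ℓ} W≤3 (λ _ _ → ≤-refl) ⟩
    (λ _ _ → 3) · blockCounts m ℓ  ≡⟨ const-· 3 (blockCounts m ℓ) ⟩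
    3 * total (blockCounts m ℓ)     ≤⟨ *-monoʳ-≤ 3 (2n≤1+4m⇒n≤2m {total (blockCounts m ℓ)} {m} 2T≤1+4m) ⟩
    3 * (2 * m)                     ≡⟨ *-assoc 3 2 m ⟨
    6 * m                           ≤⟨ *-monoˡ-≤ m {6} {8} (s≤s (s≤s (s≤s (s≤s (s≤s (s≤s z≤n)))))) ⟩
    8 * m                           ∎
    where open ≤-Reasoning

  W·slice≤8⇒W·blockCounts≤8m : (∀ s → W · slice m ℓ s ≤ 8) → W · blockCounts m ℓ ≤ 8 * m
  W·slice≤8⇒W·blockCounts≤8m W·slice≤8 = begin
    W · blockCounts m ℓ           ≡⟨ W·blockCounts≡∑slices m ℓ ⟩
    ∑[ s < m ] (W · slice m ℓ s)  ≤⟨ ∑-mono-≤ m (λ s _ → W·slice≤8 s) ⟩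
    ∑[ s < m ] 8                  ≡⟨ ∑-const m 8 ⟩
    m * 8                         ≡⟨ *-comm m 8 ⟩
    8 * m                         ∎
    where open ≤-Reasoning

  W·blockCounts≤8m : W · blockCounts m ℓ ≤ 8 * m
  W·blockCounts≤8m with slope ℓ
  ... | flat ∣Δy∣<∣Δx∣       = fewPoints⇒W·blockCounts≤8m (total-flat ∣Δy∣<∣Δx∣)
  ... | steep ∣Δx∣<∣Δy∣      = fewPoints⇒W·blockCounts≤8m (total-steep ∣Δx∣<∣Δy∣)
  ... | diagonal Δy≡Δx      = W·slice≤8⇒W·blockCounts≤8m λ s →
          W·≤8-supportedInClass sameDiagonal? W·diagonal≤8 (slice m ℓ s) (slice≤1 s) (slice-diagonal Δy≡Δx s)
  ... | antidiagonal Δy≡-Δx = W·slice≤8⇒W·blockCounts≤8m λ s →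
          W·≤8-supportedInClass sameAntidiagonal? W·antidiagonal≤8 (slice m ℓ s) (slice≤1 s) (slice-antidiagonal Δy≡-Δx s)

mainDiagonal : (m : ℕ) .{{_ : NonZero m}} → GLine (4 * m)
mainDiagonal m = mkLine (1 , 1) (2 , 2) ((1≤1 , 1≤4m) , (1≤1 , 1≤4m)) ((1≤2 , 2≤4m) , (1≤2 , 2≤4m)) (λ ()) (λ ())
  where
  1≤1 : 1 ≤ 1
  1≤1 = s≤s z≤n
  1≤2 : 1 ≤ 2
  1≤2 = s≤s z≤n
  2≤4m : 2 ≤ 4 * m
  2≤4m = ≤-trans (s≤s (s≤s z≤n)) (*-monoʳ-≤ 4 (>-nonZero⁻¹ m))
  1≤4m : 1 ≤ 4 * m
  1≤4m = ≤-trans 1≤2 2≤4m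

OnLine-mainDiagonal : ∀ m .{{_ : NonZero m}} {x y} → OnLine (mainDiagonal m) (x , y) → x ≡ y
OnLine-mainDiagonal m {x} {y} on = suc-injective (trans (OnLine-diagonal (mainDiagonal m) refl {1} {1} refl on) (+-comm y 1))

slice-mainDiagonal : ∀ m .{{_ : NonZero m}} s → s < m → ∀ i j → slice m (mainDiagonal m) s i j ≡ 𝟙 (i Fin.≟ j)
slice-mainDiagonal m s s<m i j with i Fin.≟ j
... | yes refl = ∑-single m s s<m (𝟙-yes _ refl) λ t t≢s → 𝟙-no _ λ on →
                   t≢s (sym (+-cancelˡ-≡ (toℕ i * m) _ _ (suc-injective (OnLine-mainDiagonal m on))))
... | no i≢j   = ∑≡0 m λ t t<m → 𝟙-no _ λ on →
                   i≢j (toℕ-injective (quotient-unique s<m t<m (suc-injective (OnLine-mainDiagonal m on))))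

W·blockCounts-mainDiagonal : ∀ m .{{_ : NonZero m}} → W · blockCounts m (mainDiagonal m) ≡ 8 * m
W·blockCounts-mainDiagonal m = begin
  W · blockCounts m (mainDiagonal m)          ≡⟨ W·blockCounts≡∑slices m (mainDiagonal m) ⟩
  ∑[ s < m ] (W · slice m (mainDiagonal m) s)  ≡⟨ ∑-cong m (λ s s<m → trans (·-congʳ W (slice-mainDiagonal m s s<m)) W·identity≡8) ⟩
  ∑[ s < m ] 8                                ≡⟨ ∑-const m 8 ⟩
  m * 8                                       ≡⟨ *-comm m 8 ⟩
  8 * m                                       ∎
  where open ≡-Reasoning

-- Rational values

mkℚᵘ-≃ : ∀ {a b} d e → a * suc e ≡ b * suc d → mkℚᵘ (+ a) d ≃ mkℚᵘ (+ b) e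
mkℚᵘ-≃ {a} {b} d e eq = *≡* (trans (sym (ℤₚ.pos-* a (suc e))) (trans (cong +_ eq) (ℤₚ.pos-* b (suc d))))

mkℚᵘ-+ : ∀ a b d → mkℚᵘ (+ a) d ℚᵘ.+ mkℚᵘ (+ b) d ≃ mkℚᵘ (+ (a + b)) d
mkℚᵘ-+ a b d = ℚᵘₚ.≃-trans (ℚᵘₚ.≃-reflexive (cong (λ n → mkℚᵘ n _) numerator)) (mkℚᵘ-≃ _ d (cross a b d))
  where
  numerator : + a ℤ.* + suc d ℤ.+ + b ℤ.* + suc d ≡ + (a * suc d + b * suc d)
  numerator = sym (trans (ℤₚ.pos-+ (a * suc d) (b * suc d)) (cong₂ ℤ._+_ (ℤₚ.pos-* a (suc d)) (ℤₚ.pos-* b (suc d))))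
  cross : ∀ a b d → (a * suc d + b * suc d) * suc d ≡ (a + b) * (suc d * suc d)
  cross = solve-∀

mkℚᵘ-*ℕ : ∀ a b d → mkℚᵘ (+ a) d ℚᵘ.* mkℚᵘ (+ b) 0 ≃ mkℚᵘ (+ (a * b)) d
mkℚᵘ-*ℕ a b d = ℚᵘₚ.≃-trans (ℚᵘₚ.≃-reflexive (cong (λ n → mkℚᵘ n _) (sym (ℤₚ.pos-* a b)))) (mkℚᵘ-≃ _ d (cross a b d))
  where
  cross : ∀ a b d → a * b * suc d ≡ a * b * (suc d * 1)
  cross = solve-∀

toℚᵘ-[a/d+1]*b : ∀ a b d → toℚᵘ ((+ a ℚ./ suc d) ℚ.* ℕ→ℚ b) ≃ mkℚᵘ (+ (a * b)) d
toℚᵘ-[a/d+1]*b a b d = ℚᵘₚ.≃-trans (toℚᵘ-homo-* (+ a ℚ./ suc d) (ℕ→ℚ b))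
  (ℚᵘₚ.≃-trans (ℚᵘₚ.*-cong (toℚᵘ-fromℚᵘ (mkℚᵘ (+ a) d)) (toℚᵘ-fromℚᵘ (mkℚᵘ (+ b) 0))) (mkℚᵘ-*ℕ a b d))

toℚᵘ-+ : ∀ {a b A B} d → toℚᵘ a ≃ mkℚᵘ (+ A) d → toℚᵘ b ≃ mkℚᵘ (+ B) d → toℚᵘ (a ℚ.+ b) ≃ mkℚᵘ (+ (A + B)) d
toℚᵘ-+ {a} {b} {A} {B} d a≃A b≃B =
  ℚᵘₚ.≃-trans (toℚᵘ-homo-+ a b) (ℚᵘₚ.≃-trans (ℚᵘₚ.+-cong a≃A b≃B) (mkℚᵘ-+ A B d))

toℚᵘ-Σ4ℚ : ∀ d (f : Fin 4 → ℚ) (F : Fin 4 → ℕ) → (∀ i → toℚᵘ (f i) ≃ mkℚᵘ (+ F i) d) →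
           toℚᵘ (Σ4ℚ f) ≃ mkℚᵘ (+ Σ4 F) d
toℚᵘ-Σ4ℚ d f F f≃F = toℚᵘ-+ d (toℚᵘ-+ d (toℚᵘ-+ d (f≃F 0F) (f≃F 1F)) (f≃F 2F)) (f≃F 3F)
  where
  0F 1F 2F 3F : Fin 4
  0F = Fin.zero
  1F = Fin.suc Fin.zero
  2F = Fin.suc (Fin.suc Fin.zero)
  3F = Fin.suc (Fin.suc (Fin.suc Fin.zero))

toℚᵘ-E-R : ∀ d R (ℓ : GLine (4 * suc d)) → toℚᵘ (E-R (suc d) R ℓ) ≃ mkℚᵘ (+ (R · blockCounts (suc d) ℓ)) d
toℚᵘ-E-R d R ℓ = toℚᵘ-Σ4ℚ d _ _ λ i → toℚᵘ-Σ4ℚ d _ _ λ j → toℚᵘ-[a/d+1]*b (R i j) (g (suc d) i j ℓ) d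

toℚᵘ-δ₀*k : ∀ k → toℚᵘ (δ₀ *ℚ ℕ→ℚ k) ≃ mkℚᵘ (+ (4 * k)) 4
toℚᵘ-δ₀*k k = toℚᵘ-[a/d+1]*b 4 k 4

E-R≤δ₀k : ∀ d R (ℓ : GLine (4 * suc d)) k → (R · blockCounts (suc d) ℓ) * 5 ≤ 4 * k * suc d →
          E-R (suc d) R ℓ ℚ.≤ δ₀ *ℚ ℕ→ℚ k
E-R≤δ₀k d R ℓ k le = toℚᵘ-cancel-≤ (ℚᵘₚ.≤-respˡ-≃ (ℚᵘₚ.≃-sym (toℚᵘ-E-R d R ℓ)) (ℚᵘₚ.≤-respʳ-≃ (ℚᵘₚ.≃-sym (toℚᵘ-δ₀*k k))
  (*≤* (subst₂ ℤ._≤_ (ℤₚ.pos-* (R · blockCounts (suc d) ℓ) 5) (ℤₚ.pos-* (4 * k) (suc d)) (ℤ.+≤+ le)))))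

E-R≡δ₀k : ∀ d R (ℓ : GLine (4 * suc d)) k → (R · blockCounts (suc d) ℓ) * 5 ≡ 4 * k * suc d →
          E-R (suc d) R ℓ ≡ δ₀ *ℚ ℕ→ℚ k
E-R≡δ₀k d R ℓ k eq = toℚᵘ-injective (ℚᵘₚ.≃-trans (toℚᵘ-E-R d R ℓ) (ℚᵘₚ.≃-trans (mkℚᵘ-≃ d 4 eq) (ℚᵘₚ.≃-sym (toℚᵘ-δ₀*k k))))

-- The matrix R_k

Rk[10c]≡W*c : ∀ c i j → Rk (c * 10) i j ≡ W i j * c
Rk[10c]≡W*c c i j = trans (Rk≡W*[k/10] (c * 10) i j) (cong (W i j *_) (m*n/n≡m c 10))

Rk[10c]-rowSum : ∀ c i → Σ4 (λ j → Rk (c * 10) i j) ≡ c * 10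
Rk[10c]-rowSum c i = begin
  Σ4 (λ j → Rk (c * 10) i j) ≡⟨ Σ4-cong (Rk[10c]≡W*c c i) ⟩
  Σ4 (λ j → W i j * c)       ≡⟨ *-distribʳ-Σ4 c (W i) ⟨
  Σ4 (W i) * c               ≡⟨ cong (_* c) (W-rowSum i) ⟩
  10 * c                     ≡⟨ *-comm 10 c ⟩
  c * 10                     ∎
  where open ≡-Reasoning

Rk[10c]-colSum : ∀ c j → Σ4 (λ i → Rk (c * 10) i j) ≡ c * 10
Rk[10c]-colSum c j = begin
  Σ4 (λ i → Rk (c * 10) i j) ≡⟨ Σ4-cong (λ i → Rk[10c]≡W*c c i j) ⟩
  Σ4 (λ i → W i j * c)       ≡⟨ *-distribʳ-Σ4 c (λ i → W i j) ⟨
  Σ4 (λ i → W i j) * c       ≡⟨ cong (_* c) (W-colSum j) ⟩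
  10 * c                     ≡⟨ *-comm 10 c ⟩
  c * 10                     ∎
  where open ≡-Reasoning

Rk[10c]≤m : ∀ c m → 6 * (c * 10) ≤ 5 * (4 * m) → ∀ i j → Rk (c * 10) i j ≤ m
Rk[10c]≤m c m 60c≤20m i j = begin
  Rk (c * 10) i j ≡⟨ Rk[10c]≡W*c c i j ⟩
  W i j * c       ≤⟨ *-monoˡ-≤ c (W≤3 i j) ⟩
  3 * c           ≤⟨ *-cancelˡ-≤ 20 (subst₂ _≤_ (twenty-fold₁ c) (twenty-fold₂ m) 60c≤20m) ⟩
  m               ∎
  where
  open ≤-Reasoning
  twenty-fold₁ : ∀ c → 6 * (c * 10) ≡ 20 * (3 * c)
  twenty-fold₁ = solve-∀
  twenty-fold₂ : ∀ m → 5 * (4 * m) ≡ 20 * m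
  twenty-fold₂ = solve-∀

Rk[10c]·≡c*W· : ∀ c B → Rk (c * 10) · B ≡ c * (W · B)
Rk[10c]·≡c*W· c B = trans (Σ4-cong λ i → Σ4-cong λ j → cong (_* B i j) (Rk[10c]≡W*c c i j)) (scaleˡ-· c W B)

lemma3p5 : (m : ℕ) .{{_ : NonZero m}} (k : ℕ) → 10 ∣ k → 6 * k ≤ 5 * (4 * m) →
    Feasible m k δ₀ (Rk k) × E≡ m (Rk k) (δ₀ *ℚ ℕ→ℚ k)
lemma3p5 m@(suc d) .(c * 10) (divides c refl) 6k≤20m =
  (Rk[10c]≤m c m 6k≤20m , E≤δ₀k , Rk[10c]-colSum c , Rk[10c]-rowSum c) , E≤δ₀k , mainDiagonal m , attained
  where
  rescale : ∀ c m → c * (8 * m) * 5 ≡ 4 * (c * 10) * m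
  rescale = solve-∀

  E≤δ₀k : E≤ m (Rk (c * 10)) (δ₀ *ℚ ℕ→ℚ (c * 10))
  E≤δ₀k ℓ = E-R≤δ₀k d (Rk (c * 10)) ℓ (c * 10) (begin
    (Rk (c * 10) · blockCounts m ℓ) * 5 ≡⟨ cong (_* 5) (Rk[10c]·≡c*W· c (blockCounts m ℓ)) ⟩
    c * (W · blockCounts m ℓ) * 5       ≤⟨ *-monoˡ-≤ 5 (*-monoʳ-≤ c (W·blockCounts≤8m m ℓ)) ⟩
    c * (8 * m) * 5                     ≡⟨ rescale c m ⟩
    4 * (c * 10) * m                    ∎)
    where open ≤-Reasoning

  attained : E-R m (Rk (c * 10)) (mainDiagonal m) ≡ δ₀ *ℚ ℕ→ℚ (c * 10)
  attained = E-R≡δ₀k d (Rk (c * 10)) (mainDiagonal m) (c * 10) (begin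
    (Rk (c * 10) · blockCounts m (mainDiagonal m)) * 5 ≡⟨ cong (_* 5) (Rk[10c]·≡c*W· c (blockCounts m (mainDiagonal m))) ⟩
    c * (W · blockCounts m (mainDiagonal m)) * 5       ≡⟨ cong (λ x → c * x * 5) (W·blockCounts-mainDiagonal m) ⟩
    c * (8 * m) * 5                                    ≡⟨ rescale c m ⟩
    4 * (c * 10) * m                                   ∎)
    where open ≡-Reasoning
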